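{- For all positive integers $k_1,k_2,\ldots,k_n$ with $k_1\ge 2$, \[ \sum_{i=1}^{n}\bigl(k_i-1+\delta_{ni}\bigr)\,\overline{\zeta}(k_1,\ldots,k_{i-1},k_i+1,k_{i+1},\ldots,k_n) =\sum_{\substack{1\le i\le n\\ k_i\ge 2}}\ \sum_{j=0}^{k_i-2}\overline{\zeta}(k_1,\ldots,k_{i-1},k_i-j,j+1,k_{i+1},\ldots,k_n), \] where $\delta_{ni}$ is the Kronecker delta ($1$ if $i=n$, $0$ otherwise).
   Context: For positive integers $k_1,\ldots,k_n$ with $k_1\ge2$, the non-strict multiple zeta value is $\overline{\zeta}(k_1,\ldots,k_n)=\sum_{m_1\ge m_2\ge\cdots\ge m_n>0}\frac{1}{m_1^{k_1}m_2^{k_2}\cdots m_n^{k_n}}$. -}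

module Defs where

open import Data.Nat as ℕ using (ℕ; zero; suc; _∸_; _^_)
open import Data.Nat.Properties using (m^n≢0)
open import Data.Integer using (+_)
open import Data.Rational using (ℚ; _/_; _+_; _*_; 0ℚ; 1ℚ)
open import Data.List using (List; []; _∷_; length)

Σ< : ℕ → (ℕ → ℚ) → ℚ
Σ< zero    f = 0ℚ
Σ< (suc n) f = Σ< n f + f n

ℕ→ℚ : ℕ → ℚ
ℕ→ℚ n = (+ n) / 1

-- 1 / m^k for m ≥ 1, written with m = suc m'
inv-pow : ℕ → ℕ → ℚ
inv-pow m' k = (+ 1) / (suc m' ^ k) where instance _ = m^n≢0 (suc m') k

-- Truncated non-strict MZV:
-- zbarT (k₁ ∷ … ∷ kₙ) M = Σ_{M ≥ m₁ ≥ m₂ ≥ … ≥ mₙ ≥ 1} 1/(m₁^k₁ ⋯ mₙ^kₙ)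
-- (empty index list gives 1).
zbarT : List ℕ → ℕ → ℚ
zbarT []       M = 1ℚ
zbarT (k ∷ ks) M = Σ< M (λ m' → inv-pow m' k * zbarT ks (suc m'))

-- i-th entry (0-based); default 0 out of range (never used out of range)
at : ℕ → List ℕ → ℕ
at _       []       = 0
at zero    (k ∷ ks) = k
at (suc i) (k ∷ ks) = at i ks

incAt : ℕ → List ℕ → List ℕ
incAt _       []       = []
incAt zero    (k ∷ ks) = suc k ∷ ks
incAt (suc i) (k ∷ ks) = k ∷ incAt i ks

splitAt : ℕ → ℕ → List ℕ → List ℕ
splitAt _       j []       = []
splitAt zero    j (k ∷ ks) = (k ∸ j) ∷ suc j ∷ ks
splitAt (suc i) j (k ∷ ks) = k ∷ splitAt i j ks

δ : ℕ → ℕ → ℕ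
δ zero    zero    = 1
δ zero    (suc _) = 0
δ (suc _) zero    = 0
δ (suc a) (suc b) = δ a b

-- Truncation at m₁ ≤ M of the left-hand side (0-based index i; n = length k, so
-- the paper's δ_{n i} becomes δ (n - 1) i).
LHS : List ℕ → ℕ → ℚ
LHS k M = Σ< (length k) (λ i →
  ℕ→ℚ ((at i k ∸ 1) ℕ.+ δ (length k ∸ 1) i) * zbarT (incAt i k) M)

-- For kᵢ ≥ 2 the inner sum runs over
-- j = 0 … kᵢ - 2, i.e. j < kᵢ - 1; for kᵢ = 1 the range j < kᵢ ∸ 1 = 0 is empty,
-- which implements the restriction kᵢ ≥ 2.
RHS : List ℕ → ℕ → ℚ
RHS k M = Σ< (length k) (λ i →
  Σ< (at i k ∸ 1) (λ j → zbarT (splitAt i j k) M))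

-- At a truncation M (that is, m₁ ≤ M) the two sides differ exactly by a nonnegative defect:
-- writing H for the harmonic numbers and ζ̄ₘ for the truncation at m₂ ≤ m,
--   LHS_M − RHS_M = Σ_{m=1}^{M} m^{−k₁} ζ̄ₘ(k₂,…,kₙ) (H_M − H_{M−m}).
-- This is proved by induction on the depth, splitting off m₁. The new terms of the inductive
-- step are double sums Σ_j M^{−(k−j)} l^{−(j+1)}, which the partial fraction
-- 1/(lM) = (1/(M−l))(1/l − 1/M) reduces to a geometric sum with two surviving terms.
-- Since H_M − H_{M−m} ≤ m/(M−m+1), m^{−2}·m/(M−m+1) = (1/(M+1))(1/m + 1/(M−m+1)) and
-- ζ̄ₘ(k₂,…,kₙ) ≤ H_M^{n−1}, the defect is at most 2 H_M^n/(M+1), and H_M ≤ log₂ M + 2.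

module Submission where

open import Defs
open import Algebra.Bundles using (CommutativeRing)
open import Data.Integer as ℤ using (-[1+_])
import Data.Integer.Properties as ℤ
open import Data.List using (List; []; _∷_; length)
open import Data.List.Relation.Unary.All using (All; []; _∷_)
open import Data.Nat as ℕ using (ℕ; zero; suc; _∸_; z≤n; s≤s)
import Data.Nat.Properties as ℕ
import Data.Nat.Tactic.RingSolver as ℕ-Ring
open import Data.Product using (∃; _×_; _,_; proj₁; proj₂)
open import Data.Sum using (inj₁; inj₂)
open import Data.Rational using (ℚ; mkℚ; _/_; _+_; _*_; _-_; -_; 0ℚ; 1ℚ; _≤_; _<_; ∣_∣; toℚᵘ; nonNegative)
open import Data.Rational.Properties
open import Data.Rational.Unnormalised as ℚᵘ using (mkℚᵘ; *≡*; *≤*; *<*)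
import Data.Rational.Unnormalised.Properties as ℚᵘ
open import Level using (0ℓ)
open import Relation.Binary.PropositionalEquality
open import Relation.Nullary.Decidable using (dec⇒maybe)
import Tactic.RingSolver as RingSolver
open import Tactic.RingSolver.Core.AlmostCommutativeRing using (AlmostCommutativeRing; fromCommutativeRing)
open import Algebra.Properties.Semiring.Exp (CommutativeRing.semiring +-*-commutativeRing) using (_^_; ^-homo-*)

ℚ-ring : AlmostCommutativeRing 0ℓ 0ℓ
ℚ-ring = fromCommutativeRing +-*-commutativeRing (λ x → dec⇒maybe (0ℚ ≟ x))

-- Fractions of natural numbers and unit fractions

-- frac a d = a/(d+1): shifting the denominator keeps every such fraction well defined.
frac : ℕ → ℕ → ℚ
frac a d = ℤ.+ a / suc d

toℚᵘ-frac : ∀ a d → toℚᵘ (frac a d) ℚᵘ.≃ mkℚᵘ (ℤ.+ a) d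
toℚᵘ-frac a d = toℚᵘ-fromℚᵘ (mkℚᵘ (ℤ.+ a) d)

frac-≡ : ∀ a b c d → a ℕ.* suc d ≡ c ℕ.* suc b → frac a b ≡ frac c d
frac-≡ a b c d eq = fromℚᵘ-cong {mkℚᵘ (ℤ.+ a) b} {mkℚᵘ (ℤ.+ c) d} (*≡* (begin
  ℤ.+ a ℤ.* ℤ.+ suc d  ≡⟨ ℤ.pos-* a (suc d) ⟨
  ℤ.+ (a ℕ.* suc d)    ≡⟨ cong ℤ.+_ eq ⟩
  ℤ.+ (c ℕ.* suc b)    ≡⟨ ℤ.pos-* c (suc b) ⟩
  ℤ.+ c ℤ.* ℤ.+ suc b  ∎))
  where open ≡-Reasoning

frac-* : ∀ a b c d → frac a b * frac c d ≡ frac (a ℕ.* c) (d ℕ.+ b ℕ.* suc d)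
frac-* a b c d = toℚᵘ-injective (begin-equality
  toℚᵘ (frac a b * frac c d)            ≃⟨ toℚᵘ-homo-* (frac a b) (frac c d) ⟩
  toℚᵘ (frac a b) ℚᵘ.* toℚᵘ (frac c d)  ≃⟨ ℚᵘ.*-cong (toℚᵘ-frac a b) (toℚᵘ-frac c d) ⟩
  mkℚᵘ (ℤ.+ a ℤ.* ℤ.+ c) D              ≡⟨ cong (λ n → mkℚᵘ n D) (ℤ.pos-* a c) ⟨
  mkℚᵘ (ℤ.+ (a ℕ.* c)) D                ≃⟨ toℚᵘ-frac (a ℕ.* c) D ⟨
  toℚᵘ (frac (a ℕ.* c) D)               ∎)
  where
  open ℚᵘ.≤-Reasoning
  D = d ℕ.+ b ℕ.* suc d

frac-+ : ∀ a b c d → frac a b + frac c d ≡ frac (a ℕ.* suc d ℕ.+ c ℕ.* suc b) (d ℕ.+ b ℕ.* suc d)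
frac-+ a b c d = toℚᵘ-injective (begin-equality
  toℚᵘ (frac a b + frac c d)                            ≃⟨ toℚᵘ-homo-+ (frac a b) (frac c d) ⟩
  toℚᵘ (frac a b) ℚᵘ.+ toℚᵘ (frac c d)                  ≃⟨ ℚᵘ.+-cong (toℚᵘ-frac a b) (toℚᵘ-frac c d) ⟩
  mkℚᵘ (ℤ.+ a ℤ.* ℤ.+ suc d ℤ.+ ℤ.+ c ℤ.* ℤ.+ suc b) D  ≡⟨ cong (λ n → mkℚᵘ n D) numerator ⟨
  mkℚᵘ (ℤ.+ (a ℕ.* suc d ℕ.+ c ℕ.* suc b)) D            ≃⟨ toℚᵘ-frac (a ℕ.* suc d ℕ.+ c ℕ.* suc b) D ⟨
  toℚᵘ (frac (a ℕ.* suc d ℕ.+ c ℕ.* suc b) D)           ∎)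
  where
  open ℚᵘ.≤-Reasoning
  D = d ℕ.+ b ℕ.* suc d
  numerator : ℤ.+ (a ℕ.* suc d ℕ.+ c ℕ.* suc b) ≡ ℤ.+ a ℤ.* ℤ.+ suc d ℤ.+ ℤ.+ c ℤ.* ℤ.+ suc b
  numerator = trans (ℤ.pos-+ (a ℕ.* suc d) (c ℕ.* suc b)) (cong₂ ℤ._+_ (ℤ.pos-* a (suc d)) (ℤ.pos-* c (suc b)))

frac-≤ : ∀ a b c d → a ℕ.* suc d ℕ.≤ c ℕ.* suc b → frac a b ≤ frac c d
frac-≤ a b c d le = toℚᵘ-cancel-≤ (begin
  toℚᵘ (frac a b)  ≃⟨ toℚᵘ-frac a b ⟩
  mkℚᵘ (ℤ.+ a) b   ≤⟨ *≤* (subst₂ ℤ._≤_ (ℤ.pos-* a (suc d)) (ℤ.pos-* c (suc b)) (ℤ.+≤+ le)) ⟩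
  mkℚᵘ (ℤ.+ c) d   ≃⟨ toℚᵘ-frac c d ⟨
  toℚᵘ (frac c d)  ∎)
  where open ℚᵘ.≤-Reasoning

frac-< : ∀ a b c d → a ℕ.* suc d ℕ.< c ℕ.* suc b → frac a b < frac c d
frac-< a b c d lt = toℚᵘ-cancel-< (begin-strict
  toℚᵘ (frac a b)  ≃⟨ toℚᵘ-frac a b ⟩
  mkℚᵘ (ℤ.+ a) b   <⟨ *<* (subst₂ ℤ._<_ (ℤ.pos-* a (suc d)) (ℤ.pos-* c (suc b)) (ℤ.+<+ lt)) ⟩
  mkℚᵘ (ℤ.+ c) d   ≃⟨ toℚᵘ-frac c d ⟨
  toℚᵘ (frac c d)  ∎)
  where open ℚᵘ.≤-Reasoning

0≤frac : ∀ a d → 0ℚ ≤ frac a d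
0≤frac a d = frac-≤ 0 0 a d z≤n

ℕ→ℚ-+ : ∀ a b → ℕ→ℚ (a ℕ.+ b) ≡ ℕ→ℚ a + ℕ→ℚ b
ℕ→ℚ-+ a b = trans (frac-≡ (a ℕ.+ b) 0 (a ℕ.* 1 ℕ.+ b ℕ.* 1) 0 (cross a b)) (sym (frac-+ a 0 b 0))
  where
  cross : ∀ a b → (a ℕ.+ b) ℕ.* 1 ≡ (a ℕ.* 1 ℕ.+ b ℕ.* 1) ℕ.* 1
  cross = ℕ-Ring.solve-∀

ℕ→ℚ-* : ∀ a b → ℕ→ℚ (a ℕ.* b) ≡ ℕ→ℚ a * ℕ→ℚ b
ℕ→ℚ-* a b = sym (frac-* a 0 b 0)

ℕ→ℚ-^ : ∀ k r → ℕ→ℚ (k ℕ.^ r) ≡ ℕ→ℚ k ^ r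
ℕ→ℚ-^ k zero    = refl
ℕ→ℚ-^ k (suc r) = trans (ℕ→ℚ-* k (k ℕ.^ r)) (cong (ℕ→ℚ k *_) (ℕ→ℚ-^ k r))

ℕ→ℚ-mono-≤ : ∀ {a b} → a ℕ.≤ b → ℕ→ℚ a ≤ ℕ→ℚ b
ℕ→ℚ-mono-≤ {a} {b} le = frac-≤ a 0 b 0 (ℕ.*-monoˡ-≤ 1 le)

*-mono-≤-nonNeg : ∀ {a b c d} → 0ℚ ≤ a → 0ℚ ≤ c → a ≤ b → c ≤ d → a * c ≤ b * d
*-mono-≤-nonNeg {a} {b} {c} {d} 0≤a 0≤c a≤b c≤d = ≤-trans
  (*-monoʳ-≤-nonNeg c {{nonNegative 0≤c}} a≤b)
  (*-monoˡ-≤-nonNeg b {{nonNegative (≤-trans 0≤a a≤b)}} c≤d)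

*-nonNeg : ∀ {a b} → 0ℚ ≤ a → 0ℚ ≤ b → 0ℚ ≤ a * b
*-nonNeg 0≤a 0≤b = *-mono-≤-nonNeg ≤-refl ≤-refl 0≤a 0≤b

p≤q⇒0≤q-p : ∀ {p q} → p ≤ q → 0ℚ ≤ q - p
p≤q⇒0≤q-p {p} {q} p≤q = subst (_≤ q - p) (+-inverseʳ p) (+-monoˡ-≤ (- p) p≤q)

q≤p+r⇒q-p≤r : ∀ {p q r} → q ≤ p + r → q - p ≤ r
q≤p+r⇒q-p≤r {p} {q} {r} le = subst (q - p ≤_) (cancel p r) (+-monoˡ-≤ (- p) le)
  where
  cancel : ∀ p r → p + r - p ≡ r
  cancel = RingSolver.solve-∀ ℚ-ring

^-nonNeg : ∀ {x} n → 0ℚ ≤ x → 0ℚ ≤ x ^ n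
^-nonNeg zero    0≤x = 0≤frac 1 0
^-nonNeg (suc n) 0≤x = *-nonNeg 0≤x (^-nonNeg n 0≤x)

^-monoˡ-≤ : ∀ {x y} n → 0ℚ ≤ x → x ≤ y → x ^ n ≤ y ^ n
^-monoˡ-≤ zero    0≤x x≤y = ≤-refl
^-monoˡ-≤ (suc n) 0≤x x≤y = *-mono-≤-nonNeg 0≤x (^-nonNeg n 0≤x) x≤y (^-monoˡ-≤ n 0≤x x≤y)

^-suc≤ : ∀ {x} n → 0ℚ ≤ x → x ≤ 1ℚ → x ^ suc n ≤ x
^-suc≤ {x} n 0≤x x≤1 = begin
  x * x ^ n   ≤⟨ *-monoˡ-≤-nonNeg x {{nonNegative 0≤x}} (^-monoˡ-≤ n 0≤x x≤1) ⟩
  x * 1ℚ ^ n  ≡⟨ cong (x *_) (1^n≡1 n) ⟩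
  x * 1ℚ      ≡⟨ *-identityʳ x ⟩
  x           ∎
  where
  open ≤-Reasoning
  1^n≡1 : ∀ n → 1ℚ ^ n ≡ 1ℚ
  1^n≡1 zero    = refl
  1^n≡1 (suc n) = trans (*-identityˡ _) (1^n≡1 n)

1/suc : ℕ → ℚ
1/suc m = frac 1 m

1/suc-nonNeg : ∀ m → 0ℚ ≤ 1/suc m
1/suc-nonNeg m = 0≤frac 1 m

1/suc≤1 : ∀ m → 1/suc m ≤ 1ℚ
1/suc≤1 m = frac-≤ 1 m 1 0 (s≤s z≤n)

1/suc-antimono : ∀ {m n} → m ℕ.≤ n → 1/suc n ≤ 1/suc m
1/suc-antimono le = frac-≤ 1 _ 1 _ (ℕ.*-monoʳ-≤ 1 (s≤s le))

suc*1/suc≡1 : ∀ m → ℕ→ℚ (suc m) * 1/suc m ≡ 1ℚ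
suc*1/suc≡1 m = trans (frac-* (suc m) 0 1 m) (frac-≡ (suc m ℕ.* 1) (m ℕ.+ 0 ℕ.* suc m) 1 0 (cross m))
  where
  cross : ∀ m → suc m ℕ.* 1 ℕ.* 1 ≡ 1 ℕ.* suc (m ℕ.+ 0 ℕ.* suc m)
  cross = ℕ-Ring.solve-∀

inv-pow-suc : ∀ m k → inv-pow m (suc k) ≡ 1/suc m * inv-pow m k
inv-pow-suc m k = begin
  inv-pow m (suc k)          ≡⟨ inv-pow≡frac (suc k) ⟩
  frac 1 (ℕ.pred P)          ≡⟨ frac-≡ 1 (ℕ.pred P) 1 (D ℕ.+ m ℕ.* suc D) (cong (1 ℕ.*_) denominators) ⟩
  frac 1 (D ℕ.+ m ℕ.* suc D) ≡⟨ frac-* 1 m 1 D ⟨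
  1/suc m * frac 1 D         ≡⟨ cong (1/suc m *_) (inv-pow≡frac k) ⟨
  1/suc m * inv-pow m k      ∎
  where
  open ≡-Reasoning
  P = suc m ℕ.^ suc k
  D = ℕ.pred (suc m ℕ.^ k)
  inv-pow≡frac : ∀ k → inv-pow m k ≡ frac 1 (ℕ.pred (suc m ℕ.^ k))
  inv-pow≡frac k = /-cong {ℤ.+ 1} {suc m ℕ.^ k} {ℤ.+ 1} {suc (ℕ.pred (suc m ℕ.^ k))} refl (sym (ℕ.suc-pred (suc m ℕ.^ k)))
    where instance _ = ℕ.m^n≢0 (suc m) k
  denominators : suc (D ℕ.+ m ℕ.* suc D) ≡ suc (ℕ.pred P)
  denominators = begin
    suc m ℕ.* suc D         ≡⟨ cong (suc m ℕ.*_) (ℕ.suc-pred (suc m ℕ.^ k) {{ℕ.m^n≢0 (suc m) k}}) ⟩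
    P                       ≡⟨ ℕ.suc-pred P {{ℕ.m^n≢0 (suc m) (suc k)}} ⟨
    suc (ℕ.pred P)          ∎

inv-pow≡1/suc^ : ∀ m k → inv-pow m k ≡ 1/suc m ^ k
inv-pow≡1/suc^ m zero    = refl
inv-pow≡1/suc^ m (suc k) = trans (inv-pow-suc m k) (cong (1/suc m *_) (inv-pow≡1/suc^ m k))

inv-pow-+ : ∀ m p q → inv-pow m (p ℕ.+ q) ≡ inv-pow m p * inv-pow m q
inv-pow-+ m p q = begin
  inv-pow m (p ℕ.+ q)            ≡⟨ inv-pow≡1/suc^ m (p ℕ.+ q) ⟩
  1/suc m ^ (p ℕ.+ q)            ≡⟨ ^-homo-* (1/suc m) p q ⟩
  1/suc m ^ p * 1/suc m ^ q      ≡⟨ cong₂ _*_ (inv-pow≡1/suc^ m p) (inv-pow≡1/suc^ m q) ⟨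
  inv-pow m p * inv-pow m q      ∎
  where open ≡-Reasoning

inv-pow-nonNeg : ∀ m k → 0ℚ ≤ inv-pow m k
inv-pow-nonNeg m k = subst (0ℚ ≤_) (sym (inv-pow≡1/suc^ m k)) (^-nonNeg k (1/suc-nonNeg m))

inv-pow≤1/suc : ∀ m k → 1 ℕ.≤ k → inv-pow m k ≤ 1/suc m
inv-pow≤1/suc m (suc k) _ = subst (_≤ 1/suc m) (sym (inv-pow≡1/suc^ m (suc k))) (^-suc≤ k (1/suc-nonNeg m) (1/suc≤1 m))

inv-pow≤1/suc² : ∀ m k → 2 ℕ.≤ k → inv-pow m k ≤ 1/suc m * 1/suc m
inv-pow≤1/suc² m (suc k) (s≤s 1≤k) = subst (_≤ 1/suc m * 1/suc m) (sym (inv-pow-suc m k))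
  (*-monoˡ-≤-nonNeg (1/suc m) {{nonNegative (1/suc-nonNeg m)}} (inv-pow≤1/suc m k 1≤k))

ℕ→ℚ*1/suc<1/suc : ∀ c M q → c ℕ.* suc q ℕ.< suc M → ℕ→ℚ c * 1/suc M < 1/suc q
ℕ→ℚ*1/suc<1/suc c M q lt = subst (_< 1/suc q) (sym (frac-* c 0 1 M))
  (frac-< (c ℕ.* 1) (M ℕ.+ 0 ℕ.* suc M) 1 q (subst₂ ℕ._<_ (lhs c q) (rhs M) lt))
  where
  lhs : ∀ c q → c ℕ.* suc q ≡ c ℕ.* 1 ℕ.* suc q
  lhs = ℕ-Ring.solve-∀
  rhs : ∀ M → suc M ≡ 1 ℕ.* suc (M ℕ.+ 0 ℕ.* suc M)
  rhs = ℕ-Ring.solve-∀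

archimedean : ∀ {ε} → 0ℚ < ε → ∃ λ q → 1/suc q ≤ ε
archimedean {mkℚ (ℤ.+ zero) d _} 0<ε with drop-*<* 0<ε
... | ℤ.+<+ ()
archimedean {ε@(mkℚ (ℤ.+ suc n) d _)} _ = d , subst (1/suc d ≤_) (↥p/↧p≡p ε)
  (frac-≤ 1 d (suc n) d (ℕ.*-monoˡ-≤ (suc d) {1} {suc n} (s≤s z≤n)))
archimedean {mkℚ -[1+ n ] d _} 0<ε with drop-*<* 0<ε
... | ()

-- Finite sums

Σ<-cong : ∀ n {f g : ℕ → ℚ} → (∀ i → i ℕ.< n → f i ≡ g i) → Σ< n f ≡ Σ< n g
Σ<-cong zero    f≡g = refl
Σ<-cong (suc n) f≡g = cong₂ _+_ (Σ<-cong n (λ i i<n → f≡g i (ℕ.m<n⇒m<1+n i<n))) (f≡g n ℕ.≤-refl)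

Σ<-0 : ∀ n → Σ< n (λ _ → 0ℚ) ≡ 0ℚ
Σ<-0 zero    = refl
Σ<-0 (suc n) = trans (+-identityʳ _) (Σ<-0 n)

Σ<-+ : ∀ n (f g : ℕ → ℚ) → Σ< n (λ i → f i + g i) ≡ Σ< n f + Σ< n g
Σ<-+ zero    f g = sym (+-identityˡ 0ℚ)
Σ<-+ (suc n) f g = trans (cong (_+ (f n + g n)) (Σ<-+ n f g)) (interchange (Σ< n f) (Σ< n g) (f n) (g n))
  where
  interchange : ∀ a b c d → (a + b) + (c + d) ≡ (a + c) + (b + d)
  interchange = RingSolver.solve-∀ ℚ-ring

Σ<-*ˡ : ∀ n c (f : ℕ → ℚ) → Σ< n (λ i → c * f i) ≡ c * Σ< n f
Σ<-*ˡ zero    c f = sym (*-zeroʳ c)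
Σ<-*ˡ (suc n) c f = trans (cong (_+ c * f n) (Σ<-*ˡ n c f)) (sym (*-distribˡ-+ c (Σ< n f) (f n)))

Σ<-*ʳ : ∀ n c (f : ℕ → ℚ) → Σ< n (λ i → f i * c) ≡ Σ< n f * c
Σ<-*ʳ n c f = trans (Σ<-cong n (λ i _ → *-comm (f i) c)) (trans (Σ<-*ˡ n c f) (*-comm c (Σ< n f)))

Σ<-neg : ∀ n (f : ℕ → ℚ) → Σ< n (λ i → - f i) ≡ - Σ< n f
Σ<-neg zero    f = refl
Σ<-neg (suc n) f = trans (cong (_+ - f n) (Σ<-neg n f)) (sym (neg-distrib-+ (Σ< n f) (f n)))

Σ<-sub : ∀ n (f g : ℕ → ℚ) → Σ< n (λ i → f i - g i) ≡ Σ< n f - Σ< n g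
Σ<-sub n f g = trans (Σ<-+ n f (λ i → - g i)) (cong (Σ< n f +_) (Σ<-neg n g))

Σ<-head : ∀ n (f : ℕ → ℚ) → Σ< (suc n) f ≡ f 0 + Σ< n (λ i → f (suc i))
Σ<-head zero    f = trans (+-identityˡ (f 0)) (sym (+-identityʳ (f 0)))
Σ<-head (suc n) f = trans (cong (_+ f (suc n)) (Σ<-head n f)) (+-assoc (f 0) _ _)

Σ<-swap : ∀ n m (f : ℕ → ℕ → ℚ) → Σ< n (λ i → Σ< m (f i)) ≡ Σ< m (λ j → Σ< n (λ i → f i j))
Σ<-swap zero    m f = sym (Σ<-0 m)
Σ<-swap (suc n) m f = trans (cong (_+ Σ< m (f n)) (Σ<-swap n m f)) (sym (Σ<-+ m (λ j → Σ< n (λ i → f i j)) (f n)))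

Σ<-reverse : ∀ n (f : ℕ → ℚ) → Σ< n (λ i → f (n ∸ suc i)) ≡ Σ< n f
Σ<-reverse zero    f = refl
Σ<-reverse (suc n) f = begin
  Σ< n (λ i → f (n ∸ i)) + f (n ∸ n)      ≡⟨ cong₂ _+_ (Σ<-cong n (λ i i<n → cong f (ℕ.+-∸-assoc 1 i<n))) (cong f (ℕ.n∸n≡0 n)) ⟩
  Σ< n (λ i → f (suc (n ∸ suc i))) + f 0  ≡⟨ cong (_+ f 0) (Σ<-reverse n (λ i → f (suc i))) ⟩
  Σ< n (λ i → f (suc i)) + f 0            ≡⟨ +-comm _ (f 0) ⟩
  f 0 + Σ< n (λ i → f (suc i))            ≡⟨ Σ<-head n f ⟨
  Σ< (suc n) f                            ∎
  where open ≡-Reasoning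

Σ<-const : ∀ n c → Σ< n (λ _ → c) ≡ ℕ→ℚ n * c
Σ<-const zero    c = sym (*-zeroˡ c)
Σ<-const (suc n) c = begin
  Σ< n (λ _ → c) + c        ≡⟨ cong (_+ c) (Σ<-const n c) ⟩
  ℕ→ℚ n * c + c             ≡⟨ cong (ℕ→ℚ n * c +_) (*-identityˡ c) ⟨
  ℕ→ℚ n * c + 1ℚ * c        ≡⟨ *-distribʳ-+ c (ℕ→ℚ n) 1ℚ ⟨
  (ℕ→ℚ n + ℕ→ℚ 1) * c       ≡⟨ cong (_* c) (ℕ→ℚ-+ n 1) ⟨
  ℕ→ℚ (n ℕ.+ 1) * c         ≡⟨ cong (λ k → ℕ→ℚ k * c) (ℕ.+-comm n 1) ⟩
  ℕ→ℚ (suc n) * c           ∎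
  where open ≡-Reasoning

Σ<-mono-≤ : ∀ n {f g : ℕ → ℚ} → (∀ i → i ℕ.< n → f i ≤ g i) → Σ< n f ≤ Σ< n g
Σ<-mono-≤ zero    f≤g = ≤-refl
Σ<-mono-≤ (suc n) f≤g = +-mono-≤ (Σ<-mono-≤ n (λ i i<n → f≤g i (ℕ.m<n⇒m<1+n i<n))) (f≤g n ℕ.≤-refl)

Σ<-nonNeg : ∀ n {f : ℕ → ℚ} → (∀ i → i ℕ.< n → 0ℚ ≤ f i) → 0ℚ ≤ Σ< n f
Σ<-nonNeg n {f} 0≤f = subst (_≤ Σ< n f) (Σ<-0 n) (Σ<-mono-≤ n 0≤f)

Σ<-factorˡ : ∀ n M (p : ℕ → ℚ) (z : ℕ → ℕ → ℚ) →
  Σ< n (λ i → Σ< M (λ m → p m * z i m)) ≡ Σ< M (λ m → p m * Σ< n (λ i → z i m))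
Σ<-factorˡ n M p z = trans (Σ<-swap n M (λ i m → p m * z i m)) (Σ<-cong M (λ m _ → Σ<-*ˡ n (p m) (λ i → z i m)))

Σ<-convolution : ∀ M (f g : ℕ → ℚ) →
  Σ< M (λ l → Σ< (suc l) f * g (M ∸ suc l)) ≡ Σ< M (λ p → f p * Σ< (M ∸ p) g)
Σ<-convolution zero    f g = refl
Σ<-convolution (suc M) f g = begin
  Σ< (suc M) (λ l → Σ< (suc l) f * g (M ∸ l))
    ≡⟨ Σ<-head M _ ⟩
  (0ℚ + f 0) * g M + Σ< M (λ l → Σ< (suc (suc l)) f * g (M ∸ suc l))
    ≡⟨ cong₂ _+_ (cong (_* g M) (+-identityˡ (f 0))) (Σ<-cong M (λ l _ → split-first l)) ⟩
  f 0 * g M + Σ< M (λ l → f 0 * g (M ∸ suc l) + Σ< (suc l) f′ * g (M ∸ suc l))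
    ≡⟨ cong (f 0 * g M +_) (Σ<-+ M _ _) ⟩
  f 0 * g M + (Σ< M (λ l → f 0 * g (M ∸ suc l)) + Σ< M (λ l → Σ< (suc l) f′ * g (M ∸ suc l)))
    ≡⟨ cong₂ (λ s t → f 0 * g M + (s + t))
         (trans (Σ<-*ˡ M (f 0) (λ l → g (M ∸ suc l))) (cong (f 0 *_) (Σ<-reverse M g)))
         (Σ<-convolution M f′ g) ⟩
  f 0 * g M + (f 0 * Σ< M g + Σ< M (λ p → f′ p * Σ< (M ∸ p) g))
    ≡⟨ regroup (f 0) (g M) (Σ< M g) _ ⟩
  f 0 * Σ< (suc M) g + Σ< M (λ p → f′ p * Σ< (M ∸ p) g)
    ≡⟨ Σ<-head M (λ p → f p * Σ< (suc M ∸ p) g) ⟨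
  Σ< (suc M) (λ p → f p * Σ< (suc M ∸ p) g) ∎
  where
  open ≡-Reasoning
  f′ : ℕ → ℚ
  f′ i = f (suc i)
  split-first : ∀ l → Σ< (suc (suc l)) f * g (M ∸ suc l) ≡ f 0 * g (M ∸ suc l) + Σ< (suc l) f′ * g (M ∸ suc l)
  split-first l = trans (cong (_* g (M ∸ suc l)) (Σ<-head (suc l) f)) (*-distribʳ-+ (g (M ∸ suc l)) (f 0) _)
  regroup : ∀ a b s t → a * b + (a * s + t) ≡ a * (s + b) + t
  regroup = RingSolver.solve-∀ ℚ-ring

-- Partial fractions and harmonic numbers

partial-fraction : ∀ {l M} → l ℕ.< M → 1/suc (M ∸ suc l) * (1/suc l - 1/suc M) ≡ 1/suc M * 1/suc l
partial-fraction {l} {M} l<M = begin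
  u * (y - x)                               ≡⟨ cong₂ (λ p q → u * (p - q)) (*-identityʳ y) (*-identityʳ x) ⟨
  u * (y * 1ℚ - x * 1ℚ)                     ≡⟨ cong₂ (λ p q → u * (y * p - x * q)) (unit M) (unit l) ⟨
  u * (y * (x * C) - x * (y * A))           ≡⟨ cong (λ C → u * (y * (x * C) - x * (y * A))) C≡A+B ⟩
  u * (y * (x * (A + B)) - x * (y * A))     ≡⟨ cancel u x y A B ⟩
  x * y * (u * B)                           ≡⟨ cong (x * y *_) (unit (M ∸ suc l)) ⟩
  x * y * 1ℚ                                ≡⟨ *-identityʳ (x * y) ⟩
  x * y                                     ∎
  where
  open ≡-Reasoning
  x = 1/suc M
  y = 1/suc l
  u = 1/suc (M ∸ suc l)
  A = ℕ→ℚ (suc l)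
  B = ℕ→ℚ (suc (M ∸ suc l))
  C = ℕ→ℚ (suc M)
  unit : ∀ m → 1/suc m * ℕ→ℚ (suc m) ≡ 1ℚ
  unit m = trans (*-comm (1/suc m) _) (suc*1/suc≡1 m)
  C≡A+B : C ≡ A + B
  C≡A+B = trans (cong ℕ→ℚ (sym (trans (ℕ.+-suc (suc l) (M ∸ suc l)) (cong suc (ℕ.m+[n∸m]≡n l<M)))))
                (ℕ→ℚ-+ (suc l) (suc (M ∸ suc l)))
  cancel : ∀ u x y A B → u * (y * (x * (A + B)) - x * (y * A)) ≡ x * y * (u * B)
  cancel = RingSolver.solve-∀ ℚ-ring

1/suc-*-1/suc : ∀ {l M} → l ℕ.< M → 1/suc l * 1/suc (M ∸ suc l) ≡ 1/suc M * (1/suc l + 1/suc (M ∸ suc l))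
1/suc-*-1/suc {l} {M} l<M = begin
  y * u                   ≡⟨ expand u x y ⟩
  u * (y - x) + x * u     ≡⟨ cong (_+ x * u) (partial-fraction l<M) ⟩
  x * y + x * u           ≡⟨ *-distribˡ-+ x y u ⟨
  x * (y + u)             ∎
  where
  open ≡-Reasoning
  x = 1/suc M
  y = 1/suc l
  u = 1/suc (M ∸ suc l)
  expand : ∀ u x y → y * u ≡ u * (y - x) + x * u
  expand = RingSolver.solve-∀ ℚ-ring

geometric-sum : ∀ {x y u} → u * (y - x) ≡ x * y → ∀ n →
  Σ< n (λ j → x ^ (suc n ∸ j) * y ^ suc j) ≡ y ^ suc n * (u - x) - x ^ suc n * u
geometric-sum {x} {y} {u} uy-ux≡xy zero = sym (begin
  y * 1ℚ * (u - x) - x * 1ℚ * u    ≡⟨ base x y u ⟩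
  u * (y - x) - x * y              ≡⟨ cong (_- x * y) uy-ux≡xy ⟩
  x * y - x * y                    ≡⟨ +-inverseʳ (x * y) ⟩
  0ℚ                               ∎)
  where
  open ≡-Reasoning
  base : ∀ x y u → y * 1ℚ * (u - x) - x * 1ℚ * u ≡ u * (y - x) - x * y
  base = RingSolver.solve-∀ ℚ-ring
geometric-sum {x} {y} {u} uy-ux≡xy (suc n) = begin
  Σ< n (λ j → x ^ (2 ℕ.+ n ∸ j) * y ^ suc j) + x ^ (2 ℕ.+ n ∸ n) * Y
    ≡⟨ cong₂ _+_ (Σ<-cong n (λ j j<n → trans (cong (λ e → x ^ e * y ^ suc j) (ℕ.+-∸-assoc 1 {suc n} {j} (ℕ.m≤n⇒m≤1+n (ℕ.<⇒≤ j<n))))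
                                           (*-assoc x _ _)))
                 (cong (λ e → x ^ e * Y) (ℕ.m+n∸n≡m 2 n)) ⟩
  Σ< n (λ j → x * (x ^ (suc n ∸ j) * y ^ suc j)) + x * (x * 1ℚ) * Y
    ≡⟨ cong (_+ x * (x * 1ℚ) * Y) (trans (Σ<-*ˡ n x _) (cong (x *_) (geometric-sum uy-ux≡xy n))) ⟩
  x * (Y * (u - x) - X * u) + x * (x * 1ℚ) * Y
    ≡⟨ step x y u X Y ⟩
  y * Y * (u - x) - x * X * u - Y * (u * (y - x) - x * y)
    ≡⟨ cong (λ e → y * Y * (u - x) - x * X * u - Y * (e - x * y)) uy-ux≡xy ⟩
  y * Y * (u - x) - x * X * u - Y * (x * y - x * y)
    ≡⟨ finish (y * Y * (u - x) - x * X * u) Y (x * y) ⟩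
  y * Y * (u - x) - x * X * u ∎
  where
  open ≡-Reasoning
  X = x ^ suc n
  Y = y ^ suc n
  step : ∀ x y u X Y → x * (Y * (u - x) - X * u) + x * (x * 1ℚ) * Y ≡ y * Y * (u - x) - x * X * u - Y * (u * (y - x) - x * y)
  step = RingSolver.solve-∀ ℚ-ring
  finish : ∀ s Y p → s - Y * (p - p) ≡ s
  finish = RingSolver.solve-∀ ℚ-ring

harmonic : ℕ → ℚ
harmonic n = Σ< n 1/suc

harmonic-≤-suc : ∀ n → harmonic n ≤ harmonic (suc n)
harmonic-≤-suc n = subst (_≤ harmonic (suc n)) (+-identityʳ (harmonic n)) (+-monoʳ-≤ (harmonic n) (1/suc-nonNeg n))

harmonic-mono-≤ : ∀ {m n} → m ℕ.≤ n → harmonic m ≤ harmonic n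
harmonic-mono-≤ m≤n = go (ℕ.≤⇒≤′ m≤n)
  where
  go : ∀ {m n} → m ℕ.≤′ n → harmonic m ≤ harmonic n
  go ℕ.≤′-refl                    = ≤-refl
  go {n = suc n} (ℕ.≤′-step m≤′n) = ≤-trans (go m≤′n) (harmonic-≤-suc n)

harmonic-nonNeg : ∀ n → 0ℚ ≤ harmonic n
harmonic-nonNeg n = harmonic-mono-≤ {0} {n} z≤n

harmonic-+-≤ : ∀ d s → harmonic (d ℕ.+ s) ≤ harmonic d + ℕ→ℚ s * 1/suc d
harmonic-+-≤ d zero = begin
  harmonic (d ℕ.+ 0)           ≡⟨ cong harmonic (ℕ.+-identityʳ d) ⟩
  harmonic d                   ≡⟨ +-identityʳ (harmonic d) ⟨
  harmonic d + 0ℚ              ≡⟨ cong (harmonic d +_) (*-zeroˡ (1/suc d)) ⟨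
  harmonic d + 0ℚ * 1/suc d    ∎
  where open ≤-Reasoning
harmonic-+-≤ d (suc s) = begin
  harmonic (d ℕ.+ suc s)                          ≡⟨ cong harmonic (ℕ.+-suc d s) ⟩
  harmonic (d ℕ.+ s) + 1/suc (d ℕ.+ s)            ≤⟨ +-mono-≤ (harmonic-+-≤ d s) (1/suc-antimono (ℕ.m≤m+n d s)) ⟩
  harmonic d + ℕ→ℚ s * 1/suc d + 1/suc d          ≡⟨ regroup (harmonic d) (ℕ→ℚ s) (1/suc d) ⟩
  harmonic d + (ℕ→ℚ s + ℕ→ℚ 1) * 1/suc d          ≡⟨ cong (λ t → harmonic d + t * 1/suc d) (ℕ→ℚ-+ s 1) ⟨
  harmonic d + ℕ→ℚ (s ℕ.+ 1) * 1/suc d            ≡⟨ cong (λ t → harmonic d + ℕ→ℚ t * 1/suc d) (ℕ.+-comm s 1) ⟩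
  harmonic d + ℕ→ℚ (suc s) * 1/suc d              ∎
  where
  open ≤-Reasoning
  regroup : ∀ h s x → h + s * x + x ≡ h + (s + 1ℚ) * x
  regroup = RingSolver.solve-∀ ℚ-ring

harmonic-2^-≤ : ∀ L → harmonic (2 ℕ.^ L) ≤ ℕ→ℚ (suc L)
harmonic-2^-≤ zero    = ≤-refl
harmonic-2^-≤ (suc L) = begin
  harmonic (2 ℕ.^ suc L)                        ≡⟨ cong (λ k → harmonic (P ℕ.+ k)) (ℕ.+-identityʳ P) ⟩
  harmonic (P ℕ.+ P)                            ≤⟨ harmonic-+-≤ P P ⟩
  harmonic P + ℕ→ℚ P * 1/suc P                  ≤⟨ +-mono-≤ (harmonic-2^-≤ L) P/sucP≤1 ⟩
  ℕ→ℚ (suc L) + ℕ→ℚ 1                           ≡⟨ ℕ→ℚ-+ (suc L) 1 ⟨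
  ℕ→ℚ (suc L ℕ.+ 1)                             ≡⟨ cong ℕ→ℚ (ℕ.+-comm (suc L) 1) ⟩
  ℕ→ℚ (suc (suc L))                             ∎
  where
  open ≤-Reasoning
  P = 2 ℕ.^ L
  P/sucP≤1 : ℕ→ℚ P * 1/suc P ≤ 1ℚ
  P/sucP≤1 = begin
    ℕ→ℚ P * 1/suc P          ≤⟨ *-monoʳ-≤-nonNeg (1/suc P) {{nonNegative (1/suc-nonNeg P)}} (ℕ→ℚ-mono-≤ (ℕ.n≤1+n P)) ⟩
    ℕ→ℚ (suc P) * 1/suc P    ≡⟨ suc*1/suc≡1 P ⟩
    1ℚ                       ∎

harmonic-≤-log : ∀ {M} L → M ℕ.≤ 2 ℕ.^ suc L → harmonic M ≤ ℕ→ℚ (2 ℕ.+ L)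
harmonic-≤-log {M} L M≤2^L+1 = begin
  harmonic M                 ≤⟨ harmonic-mono-≤ M≤2^L+1 ⟩
  harmonic (2 ℕ.^ suc L)     ≤⟨ harmonic-2^-≤ (suc L) ⟩
  ℕ→ℚ (2 ℕ.+ L)              ∎
  where open ≤-Reasoning

-- The exact identity at a finite truncation

defect : ℕ → (ℕ → ℚ) → ℕ → ℚ
defect a W M = Σ< M (λ m → inv-pow m a * W m * (harmonic M - harmonic (M ∸ suc m)))

-- For the weights w p = (p+1)^{−b} ζ̄_{p+1}(ks), W l is zbarT (b ∷ ks) (l+1), raised and split j are
-- the truncations of ζ̄(a+1, b, ks) and ζ̄(a−j, j+1, b, ks), and tailDefect m is the defect of
-- (b ∷ ks) at truncation m+1. Depth one is the case w = unitWeight.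
module WeightedIdentity (a′ : ℕ) (w : ℕ → ℚ) where

  a : ℕ
  a = suc a′

  W : ℕ → ℚ
  W l = Σ< (suc l) w

  tailDefect : ℕ → ℚ
  tailDefect m = Σ< (suc m) (λ p → w p * (harmonic (suc m) - harmonic (m ∸ p)))

  raised : ℕ → ℚ
  raised M = Σ< M (λ m → inv-pow m (suc a) * W m)

  split : ℕ → ℕ → ℚ
  split j M = Σ< M (λ m → inv-pow m (a ∸ j) * Σ< (suc m) (λ l → inv-pow l (suc j) * W l))

  tailDefectSum : ℕ → ℚ
  tailDefectSum M = Σ< M (λ m → inv-pow m a * tailDefect m)

  drift : ℕ → ℚ
  drift M = Σ< M (λ l → inv-pow l a * W l * (1/suc (M ∸ suc l) - 1/suc M))

  W⋆1/suc : ℕ → ℚ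
  W⋆1/suc M = Σ< M (λ l → W l * 1/suc (M ∸ suc l))

  mixedPowers : ℕ → ℕ → ℚ
  mixedPowers M l = Σ< a′ (λ j → inv-pow M (a ∸ j) * inv-pow l (suc j))

  defect-suc : ∀ M → defect a W (suc M) ≡ defect a W M - drift M + inv-pow M a * W M * harmonic (suc M)
  defect-suc M = begin
    Σ< M (λ m → inv-pow m a * W m * (harmonic (suc M) - harmonic (M ∸ m))) + inv-pow M a * W M * (harmonic (suc M) - harmonic (M ∸ M))
      ≡⟨ cong₂ _+_ (Σ<-cong M (λ m m<M → trans (cong (λ k → inv-pow m a * W m * (harmonic (suc M) - harmonic k)) (ℕ.+-∸-assoc 1 m<M))
                                                (shift (inv-pow m a * W m) (harmonic M) (harmonic (M ∸ suc m)) (1/suc M) (1/suc (M ∸ suc m)))))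
                   (cong (λ k → inv-pow M a * W M * (harmonic (suc M) - harmonic k)) (ℕ.n∸n≡0 M)) ⟩
    Σ< M (λ m → inv-pow m a * W m * (harmonic M - harmonic (M ∸ suc m)) - inv-pow m a * W m * (1/suc (M ∸ suc m) - 1/suc M))
      + inv-pow M a * W M * (harmonic (suc M) - 0ℚ)
      ≡⟨ cong₂ _+_ (Σ<-sub M _ _) (cong (inv-pow M a * W M *_) (+-identityʳ (harmonic (suc M)))) ⟩
    defect a W M - drift M + inv-pow M a * W M * harmonic (suc M) ∎
    where
    open ≡-Reasoning
    shift : ∀ c H H′ x u → c * ((H + x) - (H′ + u)) ≡ c * (H - H′) - c * (u - x)
    shift = RingSolver.solve-∀ ℚ-ring

  tailDefect-convolution : ∀ M → tailDefect M ≡ W M * harmonic (suc M) - W⋆1/suc M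
  tailDefect-convolution M = begin
    Σ< (suc M) (λ p → w p * (harmonic (suc M) - harmonic (M ∸ p)))
      ≡⟨ trans (Σ<-cong (suc M) (λ p _ → *-distribˡ-+ (w p) _ _)) (Σ<-+ (suc M) _ _) ⟩
    Σ< (suc M) (λ p → w p * harmonic (suc M)) + Σ< (suc M) (λ p → w p * - harmonic (M ∸ p))
      ≡⟨ cong₂ _+_ (Σ<-*ʳ (suc M) (harmonic (suc M)) w)
                   (trans (Σ<-cong (suc M) (λ p _ → sym (neg-distribʳ-* (w p) _))) (Σ<-neg (suc M) _)) ⟩
    W M * harmonic (suc M) - (Σ< M (λ p → w p * harmonic (M ∸ p)) + w M * harmonic (M ∸ M))
      ≡⟨ cong (λ k → W M * harmonic (suc M) - (Σ< M (λ p → w p * harmonic (M ∸ p)) + w M * harmonic k)) (ℕ.n∸n≡0 M) ⟩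
    W M * harmonic (suc M) - (Σ< M (λ p → w p * harmonic (M ∸ p)) + w M * 0ℚ)
      ≡⟨ cong (λ s → W M * harmonic (suc M) - s)
              (trans (cong (Σ< M (λ p → w p * harmonic (M ∸ p)) +_) (*-zeroʳ (w M))) (+-identityʳ _)) ⟩
    W M * harmonic (suc M) - Σ< M (λ p → w p * harmonic (M ∸ p))
      ≡⟨ cong (λ s → W M * harmonic (suc M) - s) (Σ<-convolution M w 1/suc) ⟨
    W M * harmonic (suc M) - W⋆1/suc M ∎
    where open ≡-Reasoning

  mixedPowers-diagonal : ∀ M → mixedPowers M M ≡ ℕ→ℚ a′ * inv-pow M (suc a)
  mixedPowers-diagonal M = trans (Σ<-cong a′ (λ j j<a′ → trans (sym (inv-pow-+ M (a ∸ j) (suc j))) (cong (inv-pow M) (exponent j<a′))))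
                                 (Σ<-const a′ (inv-pow M (suc a)))
    where
    exponent : ∀ {j} → j ℕ.< a′ → a ∸ j ℕ.+ suc j ≡ suc a
    exponent {j} j<a′ = trans (ℕ.+-suc (a ∸ j) j) (cong suc (ℕ.m∸n+n≡m (ℕ.m≤n⇒m≤1+n (ℕ.<⇒≤ j<a′))))

  mixedPowers-below : ∀ {l M} → l ℕ.< M →
    mixedPowers M l ≡ inv-pow l a * (1/suc (M ∸ suc l) - 1/suc M) - inv-pow M a * 1/suc (M ∸ suc l)
  mixedPowers-below {l} {M} l<M = begin
    mixedPowers M l
      ≡⟨ Σ<-cong a′ (λ j _ → cong₂ _*_ (inv-pow≡1/suc^ M (a ∸ j)) (inv-pow≡1/suc^ l (suc j))) ⟩
    Σ< a′ (λ j → 1/suc M ^ (a ∸ j) * 1/suc l ^ suc j)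
      ≡⟨ geometric-sum (partial-fraction l<M) a′ ⟩
    1/suc l ^ a * (1/suc (M ∸ suc l) - 1/suc M) - 1/suc M ^ a * 1/suc (M ∸ suc l)
      ≡⟨ cong₂ (λ p q → p * (1/suc (M ∸ suc l) - 1/suc M) - q * 1/suc (M ∸ suc l)) (inv-pow≡1/suc^ l a) (inv-pow≡1/suc^ M a) ⟨
    inv-pow l a * (1/suc (M ∸ suc l) - 1/suc M) - inv-pow M a * 1/suc (M ∸ suc l) ∎
    where open ≡-Reasoning

  split-increment : ∀ M →
    Σ< a′ (λ j → inv-pow M (a ∸ j) * Σ< (suc M) (λ l → inv-pow l (suc j) * W l))
      ≡ drift M - inv-pow M a * W⋆1/suc M + ℕ→ℚ a′ * inv-pow M (suc a) * W M
  split-increment M = begin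
    Σ< a′ (λ j → inv-pow M (a ∸ j) * Σ< (suc M) (λ l → inv-pow l (suc j) * W l))
      ≡⟨ Σ<-cong a′ (λ j _ → trans (sym (Σ<-*ˡ (suc M) (inv-pow M (a ∸ j)) (λ l → inv-pow l (suc j) * W l)))
                                 (Σ<-cong (suc M) (λ l _ → reorder (inv-pow M (a ∸ j)) (inv-pow l (suc j)) (W l)))) ⟩
    Σ< a′ (λ j → Σ< (suc M) (λ l → W l * (inv-pow M (a ∸ j) * inv-pow l (suc j))))
      ≡⟨ Σ<-factorˡ a′ (suc M) W _ ⟩
    Σ< M (λ l → W l * mixedPowers M l) + W M * mixedPowers M M
      ≡⟨ cong₂ _+_ (Σ<-cong M (λ l l<M → trans (cong (W l *_) (mixedPowers-below l<M))
                                                (distribute (W l) (inv-pow l a) (1/suc (M ∸ suc l)) (1/suc M) (inv-pow M a))))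
                   (cong (W M *_) (mixedPowers-diagonal M)) ⟩
    Σ< M (λ l → inv-pow l a * W l * (1/suc (M ∸ suc l) - 1/suc M) - inv-pow M a * (W l * 1/suc (M ∸ suc l)))
      + W M * (ℕ→ℚ a′ * inv-pow M (suc a))
      ≡⟨ cong₂ _+_ (trans (Σ<-sub M _ _) (cong (λ s → drift M - s) (Σ<-*ˡ M (inv-pow M a) _))) (*-comm (W M) _) ⟩
    drift M - inv-pow M a * W⋆1/suc M + ℕ→ℚ a′ * inv-pow M (suc a) * W M ∎
    where
    open ≡-Reasoning
    reorder : ∀ q p W → q * (p * W) ≡ W * (q * p)
    reorder = RingSolver.solve-∀ ℚ-ring
    distribute : ∀ W p u x q → W * (p * (u - x) - q * u) ≡ p * W * (u - x) - q * (W * u)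
    distribute = RingSolver.solve-∀ ℚ-ring

  weighted-identity : ∀ M → ℕ→ℚ a′ * raised M + tailDefectSum M ≡ Σ< a′ (λ j → split j M) + defect a W M
  weighted-identity zero    = cong (_+ 0ℚ) (trans (*-zeroʳ (ℕ→ℚ a′)) (sym (Σ<-0 a′)))
  weighted-identity (suc M) = begin
    A * (raised M + t * c) + (tailDefectSum M + q * tailDefect M)
      ≡⟨ cong (λ e → A * (raised M + t * c) + (tailDefectSum M + q * e)) (tailDefect-convolution M) ⟩
    A * (raised M + t * c) + (tailDefectSum M + q * (c * h - V))
      ≡⟨ rearrange A (raised M) t c (tailDefectSum M) q h V S (defect a W M) (drift M) (weighted-identity M) ⟩
    (S + (drift M - q * V + A * t * c)) + (defect a W M - drift M + q * c * h)
      ≡⟨ cong₂ _+_ (cong (S +_) (sym (split-increment M))) (sym (defect-suc M)) ⟩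
    (S + Σ< a′ (λ j → inv-pow M (a ∸ j) * Σ< (suc M) (λ l → inv-pow l (suc j) * W l))) + defect a W (suc M)
      ≡⟨ cong (_+ defect a W (suc M)) (Σ<-+ a′ (λ j → split j M) _) ⟨
    Σ< a′ (λ j → split j (suc M)) + defect a W (suc M) ∎
    where
    open ≡-Reasoning
    A = ℕ→ℚ a′
    t = inv-pow M (suc a)
    c = W M
    q = inv-pow M a
    h = harmonic (suc M)
    V = W⋆1/suc M
    S = Σ< a′ (λ j → split j M)
    rearrange : ∀ A T t c SE q h V S D P → A * T + SE ≡ S + D →
      A * (T + t * c) + (SE + q * (c * h - V)) ≡ (S + (P - q * V + A * t * c)) + (D - P + q * c * h)
    rearrange A T t c SE q h V S D P eq = trans (collect A T t c SE q h V)
      (trans (cong (_+ (A * t * c + q * c * h - q * V)) eq) (distribute S D P A t c q h V))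
      where
      collect : ∀ A T t c SE q h V → A * (T + t * c) + (SE + q * (c * h - V)) ≡ (A * T + SE) + (A * t * c + q * c * h - q * V)
      collect = RingSolver.solve-∀ ℚ-ring
      distribute : ∀ S D P A t c q h V → (S + D) + (A * t * c + q * c * h - q * V) ≡ (S + (P - q * V + A * t * c)) + (D - P + q * c * h)
      distribute = RingSolver.solve-∀ ℚ-ring

LHS-∷ : ∀ a b ks M → LHS (a ∷ b ∷ ks) M ≡
  ℕ→ℚ (a ∸ 1 ℕ.+ 0) * zbarT (suc a ∷ b ∷ ks) M + Σ< M (λ m → inv-pow m a * LHS (b ∷ ks) (suc m))
LHS-∷ a b ks M = trans (Σ<-head (suc (length ks)) _) (cong (ℕ→ℚ (a ∸ 1 ℕ.+ 0) * zbarT (suc a ∷ b ∷ ks) M +_) (begin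
  Σ< n (λ i → c i * Σ< M (λ m → inv-pow m a * z i m))  ≡⟨ Σ<-cong n (λ i _ → sym (Σ<-*ˡ M (c i) _)) ⟩
  Σ< n (λ i → Σ< M (λ m → c i * (inv-pow m a * z i m))) ≡⟨ Σ<-cong n (λ i _ → Σ<-cong M (λ m _ → commute (c i) (inv-pow m a) (z i m))) ⟩
  Σ< n (λ i → Σ< M (λ m → inv-pow m a * (c i * z i m))) ≡⟨ Σ<-factorˡ n M (λ m → inv-pow m a) (λ i m → c i * z i m) ⟩
  Σ< M (λ m → inv-pow m a * LHS (b ∷ ks) (suc m))       ∎))
  where
  open ≡-Reasoning
  n = suc (length ks)
  c : ℕ → ℚ
  c i = ℕ→ℚ ((at i (b ∷ ks) ∸ 1) ℕ.+ δ (length ks) i)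
  z : ℕ → ℕ → ℚ
  z i m = zbarT (incAt i (b ∷ ks)) (suc m)
  commute : ∀ c p z → c * (p * z) ≡ p * (c * z)
  commute = RingSolver.solve-∀ ℚ-ring

RHS-∷ : ∀ a ks M → RHS (a ∷ ks) M ≡
  Σ< (a ∸ 1) (λ j → zbarT (a ∸ j ∷ suc j ∷ ks) M) + Σ< M (λ m → inv-pow m a * RHS ks (suc m))
RHS-∷ a ks M = trans (Σ<-head (length ks) _) (cong (Σ< (a ∸ 1) (λ j → zbarT (a ∸ j ∷ suc j ∷ ks) M) +_)
  (trans (Σ<-cong (length ks) (λ i _ → Σ<-factorˡ (at i ks ∸ 1) M (λ m → inv-pow m a) (λ j m → zbarT (splitAt i j ks) (suc m))))
         (Σ<-factorˡ (length ks) M (λ m → inv-pow m a) (λ i m → Σ< (at i ks ∸ 1) (λ j → zbarT (splitAt i j ks) (suc m))))))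

unitWeight : ℕ → ℚ
unitWeight zero    = 1ℚ
unitWeight (suc _) = 0ℚ

Σ<-unitWeight : ∀ l → Σ< (suc l) unitWeight ≡ 1ℚ
Σ<-unitWeight l = trans (Σ<-head l unitWeight) (trans (cong (1ℚ +_) (Σ<-0 l)) (+-identityʳ 1ℚ))

Σ<-unitWeight-tail : ∀ m → Σ< (suc m) (λ p → unitWeight p * (harmonic (suc m) - harmonic (m ∸ p))) ≡ 1/suc m
Σ<-unitWeight-tail m = begin
  Σ< (suc m) (λ p → unitWeight p * (harmonic (suc m) - harmonic (m ∸ p)))
    ≡⟨ Σ<-head m _ ⟩
  1ℚ * (harmonic m + 1/suc m - harmonic m) + Σ< m (λ p → 0ℚ * (harmonic (suc m) - harmonic (m ∸ suc p)))
    ≡⟨ cong₂ _+_ (telescope (harmonic m) (1/suc m))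
                 (trans (Σ<-cong m (λ p _ → *-zeroˡ (harmonic (suc m) - harmonic (m ∸ suc p)))) (Σ<-0 m)) ⟩
  1/suc m + 0ℚ
    ≡⟨ +-identityʳ (1/suc m) ⟩
  1/suc m ∎
  where
  open ≡-Reasoning
  telescope : ∀ h x → 1ℚ * (h + x - h) ≡ x
  telescope = RingSolver.solve-∀ ℚ-ring

LHS≡RHS+defect-depth1 : ∀ a′ M → LHS (suc a′ ∷ []) M ≡ RHS (suc a′ ∷ []) M + defect (suc a′) (λ _ → 1ℚ) M
LHS≡RHS+defect-depth1 a′ M = begin
  0ℚ + ℕ→ℚ (a′ ℕ.+ 1) * Z                                 ≡⟨ cong (λ r → 0ℚ + r * Z) (ℕ→ℚ-+ a′ 1) ⟩
  0ℚ + (ℕ→ℚ a′ + 1ℚ) * Z                                  ≡⟨ expand (ℕ→ℚ a′) Z ⟩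
  ℕ→ℚ a′ * Z + Z                                          ≡⟨ cong₂ (λ r e → ℕ→ℚ a′ * r + e) raised≡Z tailDefectSum≡Z ⟨
  ℕ→ℚ a′ * raised M + tailDefectSum M                     ≡⟨ weighted-identity M ⟩
  Σ< a′ (λ j → split j M) + defect (suc a′) W M           ≡⟨ cong₂ _+_ (trans (+-identityˡ _) split≡) defect≡ ⟨
  0ℚ + Σ< a′ (λ j → zbarT (suc a′ ∸ j ∷ suc j ∷ []) M) + defect (suc a′) (λ _ → 1ℚ) M ∎
  where
  open ≡-Reasoning
  open WeightedIdentity a′ unitWeight
  Z = zbarT (suc (suc a′) ∷ []) M
  expand : ∀ r Z → 0ℚ + (r + 1ℚ) * Z ≡ r * Z + Z
  expand = RingSolver.solve-∀ ℚ-ring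
  raised≡Z : raised M ≡ Z
  raised≡Z = Σ<-cong M (λ m _ → cong (inv-pow m (suc (suc a′)) *_) (Σ<-unitWeight m))
  tailDefectSum≡Z : tailDefectSum M ≡ Z
  tailDefectSum≡Z = Σ<-cong M (λ m _ → begin
    inv-pow m (suc a′) * tailDefect m   ≡⟨ cong (inv-pow m (suc a′) *_) (Σ<-unitWeight-tail m) ⟩
    inv-pow m (suc a′) * 1/suc m        ≡⟨ *-comm _ (1/suc m) ⟩
    1/suc m * inv-pow m (suc a′)        ≡⟨ inv-pow-suc m (suc a′) ⟨
    inv-pow m (suc (suc a′))            ≡⟨ *-identityʳ _ ⟨
    inv-pow m (suc (suc a′)) * 1ℚ       ∎)
  split≡ : Σ< a′ (λ j → zbarT (suc a′ ∸ j ∷ suc j ∷ []) M) ≡ Σ< a′ (λ j → split j M)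
  split≡ = Σ<-cong a′ (λ j _ → Σ<-cong M (λ m _ → cong (inv-pow m (suc a′ ∸ j) *_)
             (Σ<-cong (suc m) (λ l _ → cong (inv-pow l (suc j) *_) (sym (Σ<-unitWeight l))))))
  defect≡ : defect (suc a′) (λ _ → 1ℚ) M ≡ defect (suc a′) W M
  defect≡ = Σ<-cong M (λ m _ → cong (λ r → inv-pow m (suc a′) * r * (harmonic M - harmonic (M ∸ suc m)))
                                    (sym (Σ<-unitWeight m)))

LHS≡RHS+defect : ∀ a ks → 1 ℕ.≤ a → All (1 ℕ.≤_) ks → ∀ M →
  LHS (a ∷ ks) M ≡ RHS (a ∷ ks) M + defect a (λ m → zbarT ks (suc m)) M
LHS≡RHS+defect (suc a′) [] _ _ M = LHS≡RHS+defect-depth1 a′ M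
LHS≡RHS+defect (suc a′) (b ∷ ks) _ (1≤b ∷ 1≤ks) M = begin
  LHS (suc a′ ∷ b ∷ ks) M
    ≡⟨ LHS-∷ (suc a′) b ks M ⟩
  ℕ→ℚ (a′ ℕ.+ 0) * raised M + Σ< M (λ m → inv-pow m (suc a′) * LHS (b ∷ ks) (suc m))
    ≡⟨ cong₂ (λ k s → ℕ→ℚ k * raised M + s) (ℕ.+-identityʳ a′) (trans (Σ<-cong M (λ m _ → tail m)) (Σ<-+ M _ _)) ⟩
  ℕ→ℚ a′ * raised M + (R + tailDefectSum M)
    ≡⟨ reassociate (ℕ→ℚ a′ * raised M) R (tailDefectSum M) (Σ< a′ (λ j → split j M)) _ (weighted-identity M) ⟩
  (Σ< a′ (λ j → split j M) + R) + defect (suc a′) W M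
    ≡⟨ cong (_+ defect (suc a′) W M) (RHS-∷ (suc a′) (b ∷ ks) M) ⟨
  RHS (suc a′ ∷ b ∷ ks) M + defect (suc a′) W M ∎
  where
  open ≡-Reasoning
  open WeightedIdentity a′ (λ p → inv-pow p b * zbarT ks (suc p))
  R = Σ< M (λ m → inv-pow m (suc a′) * RHS (b ∷ ks) (suc m))
  tail : ∀ m → inv-pow m (suc a′) * LHS (b ∷ ks) (suc m)
             ≡ inv-pow m (suc a′) * RHS (b ∷ ks) (suc m) + inv-pow m (suc a′) * tailDefect m
  tail m = trans (cong (inv-pow m (suc a′) *_) (LHS≡RHS+defect b ks 1≤b 1≤ks (suc m)))
                 (*-distribˡ-+ (inv-pow m (suc a′)) (RHS (b ∷ ks) (suc m)) (tailDefect m))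
  reassociate : ∀ x R y S D → x + y ≡ S + D → x + (R + y) ≡ (S + R) + D
  reassociate x R y S D eq = trans (swap x R y) (trans (cong (R +_) eq) (swap′ R S D))
    where
    swap : ∀ x R y → x + (R + y) ≡ R + (x + y)
    swap = RingSolver.solve-∀ ℚ-ring
    swap′ : ∀ R S D → R + (S + D) ≡ (S + R) + D
    swap′ = RingSolver.solve-∀ ℚ-ring

LHS-RHS≡defect : ∀ a ks → 1 ℕ.≤ a → All (1 ℕ.≤_) ks → ∀ M →
  LHS (a ∷ ks) M - RHS (a ∷ ks) M ≡ defect a (λ m → zbarT ks (suc m)) M
LHS-RHS≡defect a ks 1≤a 1≤ks M =
  trans (cong (_- RHS (a ∷ ks) M) (LHS≡RHS+defect a ks 1≤a 1≤ks M)) (cancel (RHS (a ∷ ks) M) _)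
  where
  cancel : ∀ r d → r + d - r ≡ d
  cancel = RingSolver.solve-∀ ℚ-ring

-- Size of the defect

zbarT-nonNeg : ∀ ks n → 0ℚ ≤ zbarT ks n
zbarT-nonNeg []       n = 0≤frac 1 0
zbarT-nonNeg (k ∷ ks) n = Σ<-nonNeg n (λ m _ → *-nonNeg (inv-pow-nonNeg m k) (zbarT-nonNeg ks (suc m)))

zbarT≤harmonic^length : ∀ ks → All (1 ℕ.≤_) ks → ∀ n → zbarT ks n ≤ harmonic n ^ length ks
zbarT≤harmonic^length []       _             n = ≤-refl
zbarT≤harmonic^length (k ∷ ks) (1≤k ∷ 1≤ks) n = begin
  Σ< n (λ m → inv-pow m k * zbarT ks (suc m))    ≤⟨ Σ<-mono-≤ n termwise ⟩
  Σ< n (λ m → 1/suc m * harmonic n ^ length ks)  ≡⟨ Σ<-*ʳ n (harmonic n ^ length ks) 1/suc ⟩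
  harmonic n * harmonic n ^ length ks            ∎
  where
  open ≤-Reasoning
  termwise : ∀ m → m ℕ.< n → inv-pow m k * zbarT ks (suc m) ≤ 1/suc m * harmonic n ^ length ks
  termwise m m<n = *-mono-≤-nonNeg (inv-pow-nonNeg m k) (zbarT-nonNeg ks (suc m)) (inv-pow≤1/suc m k 1≤k)
    (≤-trans (zbarT≤harmonic^length ks 1≤ks (suc m)) (^-monoˡ-≤ (length ks) (harmonic-nonNeg (suc m)) (harmonic-mono-≤ m<n)))

harmonic-difference-nonNeg : ∀ M m → 0ℚ ≤ harmonic M - harmonic (M ∸ suc m)
harmonic-difference-nonNeg M m = p≤q⇒0≤q-p (harmonic-mono-≤ (ℕ.m∸n≤m M (suc m)))

harmonic-difference-≤ : ∀ {m M} → m ℕ.< M → harmonic M - harmonic (M ∸ suc m) ≤ ℕ→ℚ (suc m) * 1/suc (M ∸ suc m)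
harmonic-difference-≤ {m} {M} m<M = q≤p+r⇒q-p≤r
  (subst (λ k → harmonic k ≤ harmonic (M ∸ suc m) + ℕ→ℚ (suc m) * 1/suc (M ∸ suc m)) (ℕ.m∸n+n≡m m<M)
         (harmonic-+-≤ (M ∸ suc m) (suc m)))

defect-nonNeg : ∀ a {W} M → (∀ m → 0ℚ ≤ W m) → 0ℚ ≤ defect a W M
defect-nonNeg a M 0≤W = Σ<-nonNeg M (λ m _ → *-nonNeg (*-nonNeg (inv-pow-nonNeg m a) (0≤W m)) (harmonic-difference-nonNeg M m))

defect-≤ : ∀ {a W B} M → 2 ℕ.≤ a → (∀ m → 0ℚ ≤ W m) → (∀ m → m ℕ.< M → W m ≤ B) →
  defect a W M ≤ B * (1/suc M * (harmonic M + harmonic M))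
defect-≤ {a} {W} {B} M 2≤a 0≤W W≤B = begin
  defect a W M                                                    ≤⟨ Σ<-mono-≤ M termwise ⟩
  Σ< M (λ m → B * (1/suc M * (1/suc m + 1/suc (M ∸ suc m))))     ≡⟨ Σ<-*ˡ M B _ ⟩
  B * Σ< M (λ m → 1/suc M * (1/suc m + 1/suc (M ∸ suc m)))       ≡⟨ cong (B *_) (Σ<-*ˡ M (1/suc M) _) ⟩
  B * (1/suc M * Σ< M (λ m → 1/suc m + 1/suc (M ∸ suc m)))       ≡⟨ cong (λ s → B * (1/suc M * s)) (Σ<-+ M 1/suc _) ⟩
  B * (1/suc M * (harmonic M + Σ< M (λ m → 1/suc (M ∸ suc m))))  ≡⟨ cong (λ s → B * (1/suc M * (harmonic M + s))) (Σ<-reverse M 1/suc) ⟩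
  B * (1/suc M * (harmonic M + harmonic M))                       ∎
  where
  open ≤-Reasoning
  termwise : ∀ m → m ℕ.< M → inv-pow m a * W m * (harmonic M - harmonic (M ∸ suc m)) ≤ B * (1/suc M * (1/suc m + 1/suc (M ∸ suc m)))
  termwise m m<M = begin
    inv-pow m a * W m * (harmonic M - harmonic (M ∸ suc m))
      ≤⟨ *-mono-≤-nonNeg (*-nonNeg (inv-pow-nonNeg m a) (0≤W m)) (harmonic-difference-nonNeg M m)
           (*-mono-≤-nonNeg (inv-pow-nonNeg m a) (0≤W m) (inv-pow≤1/suc² m a 2≤a) (W≤B m m<M))
           (harmonic-difference-≤ m<M) ⟩
    y * y * B * (s * u)     ≡⟨ regroup y B s u ⟩
    B * (y * u) * (s * y)   ≡⟨ cong (B * (y * u) *_) (suc*1/suc≡1 m) ⟩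
    B * (y * u) * 1ℚ        ≡⟨ *-identityʳ (B * (y * u)) ⟩
    B * (y * u)             ≡⟨ cong (B *_) (1/suc-*-1/suc m<M) ⟩
    B * (1/suc M * (y + u)) ∎
    where
    y = 1/suc m
    u = 1/suc (M ∸ suc m)
    s = ℕ→ℚ (suc m)
    regroup : ∀ y B s u → y * y * B * (s * u) ≡ B * (y * u) * (s * y)
    regroup = RingSolver.solve-∀ ℚ-ring

defect-≤-ℕ : ∀ a ks M K → 2 ℕ.≤ a → All (1 ℕ.≤_) ks → harmonic M ≤ ℕ→ℚ K →
  defect a (λ m → zbarT ks (suc m)) M ≤ ℕ→ℚ (K ℕ.^ length ks ℕ.* (K ℕ.+ K)) * 1/suc M
defect-≤-ℕ a ks M K 2≤a 1≤ks H≤K = begin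
  defect a (λ m → zbarT ks (suc m)) M
    ≤⟨ defect-≤ M 2≤a (λ m → zbarT-nonNeg ks (suc m)) zbarT≤ ⟩
  harmonic M ^ r * (1/suc M * (harmonic M + harmonic M))
    ≤⟨ *-mono-≤-nonNeg (^-nonNeg r (harmonic-nonNeg M)) (*-nonNeg (1/suc-nonNeg M) (+-mono-≤ (harmonic-nonNeg M) (harmonic-nonNeg M)))
         (^-monoˡ-≤ r (harmonic-nonNeg M) H≤K) (*-monoˡ-≤-nonNeg (1/suc M) {{nonNegative (1/suc-nonNeg M)}} (+-mono-≤ H≤K H≤K)) ⟩
  ℕ→ℚ K ^ r * (1/suc M * (ℕ→ℚ K + ℕ→ℚ K))
    ≡⟨ regroup (ℕ→ℚ K ^ r) (1/suc M) (ℕ→ℚ K + ℕ→ℚ K) ⟩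
  ℕ→ℚ K ^ r * (ℕ→ℚ K + ℕ→ℚ K) * 1/suc M
    ≡⟨ cong₂ (λ p s → p * s * 1/suc M) (ℕ→ℚ-^ K r) (ℕ→ℚ-+ K K) ⟨
  ℕ→ℚ (K ℕ.^ r) * ℕ→ℚ (K ℕ.+ K) * 1/suc M
    ≡⟨ cong (_* 1/suc M) (ℕ→ℚ-* (K ℕ.^ r) (K ℕ.+ K)) ⟨
  ℕ→ℚ (K ℕ.^ r ℕ.* (K ℕ.+ K)) * 1/suc M ∎
  where
  open ≤-Reasoning
  r = length ks
  zbarT≤ : ∀ m → m ℕ.< M → zbarT ks (suc m) ≤ harmonic M ^ r
  zbarT≤ m m<M = ≤-trans (zbarT≤harmonic^length ks 1≤ks (suc m)) (^-monoˡ-≤ r (harmonic-nonNeg (suc m)) (harmonic-mono-≤ m<M))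
  regroup : ∀ p x s → p * (x * s) ≡ p * s * x
  regroup = RingSolver.solve-∀ ℚ-ring

-- Powers of a logarithm grow slower than linearly

n<2^n : ∀ n → n ℕ.< 2 ℕ.^ n
n<2^n zero    = s≤s z≤n
n<2^n (suc n) = ℕ.≤-<-trans (n<2^n n) (ℕ.^-monoʳ-< 2 (s≤s (s≤s z≤n)) (ℕ.n<1+n n))

2+n≤2^n : ∀ n → 2 ℕ.≤ n → 2 ℕ.+ n ℕ.≤ 2 ℕ.^ n
2+n≤2^n n 2≤n = go (ℕ.≤⇒≤′ 2≤n)
  where
  go : ∀ {n} → 2 ℕ.≤′ n → 2 ℕ.+ n ℕ.≤ 2 ℕ.^ n
  go ℕ.≤′-refl                 = ℕ.≤-refl
  go {suc n} (ℕ.≤′-step 2≤′n) = begin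
    2 ℕ.+ suc n                     ≡⟨ ℕ.+-comm 1 (2 ℕ.+ n) ⟩
    2 ℕ.+ n ℕ.+ 1                   ≤⟨ ℕ.+-mono-≤ (go 2≤′n) (ℕ.m^n>0 2 n) ⟩
    2 ℕ.^ n ℕ.+ 2 ℕ.^ n             ≡⟨ cong (2 ℕ.^ n ℕ.+_) (ℕ.+-identityʳ (2 ℕ.^ n)) ⟨
    2 ℕ.^ suc n                     ∎
    where open ℕ.≤-Reasoning

⌊n/2⌋-bounds : ∀ n → ℕ.⌊ n /2⌋ ℕ.+ ℕ.⌊ n /2⌋ ℕ.≤ n × n ℕ.≤ suc (ℕ.⌊ n /2⌋ ℕ.+ ℕ.⌊ n /2⌋)
⌊n/2⌋-bounds n = subst (K ℕ.+ K ℕ.≤_) (ℕ.⌊n/2⌋+⌈n/2⌉≡n n) (ℕ.+-monoʳ-≤ K (ℕ.⌊n/2⌋≤⌈n/2⌉ n))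
               , subst₂ ℕ._≤_ (ℕ.⌊n/2⌋+⌈n/2⌉≡n n) (ℕ.+-suc K K) (ℕ.+-monoʳ-≤ K (⌈n/2⌉≤1+⌊n/2⌋ n))
  where
  K = ℕ.⌊ n /2⌋
  ⌈n/2⌉≤1+⌊n/2⌋ : ∀ n → ℕ.⌈ n /2⌉ ℕ.≤ suc ℕ.⌊ n /2⌋
  ⌈n/2⌉≤1+⌊n/2⌋ zero          = z≤n
  ⌈n/2⌉≤1+⌊n/2⌋ (suc zero)    = ℕ.≤-refl
  ⌈n/2⌉≤1+⌊n/2⌋ (suc (suc n)) = s≤s (⌈n/2⌉≤1+⌊n/2⌋ n)

polynomial≤exponential : ∀ n c → ∃ λ L₀ → ∀ L → L₀ ℕ.≤ L → c ℕ.* (2 ℕ.+ L) ℕ.^ n ℕ.≤ 2 ℕ.^ L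
polynomial≤exponential zero    c = c , λ L c≤L →
  ℕ.≤-trans (ℕ.≤-reflexive (ℕ.*-identityʳ c)) (ℕ.≤-trans c≤L (ℕ.<⇒≤ (n<2^n L)))
polynomial≤exponential (suc n) c = A ℕ.+ A , bound
  where
  c′ = c ℕ.* 2 ℕ.^ suc n
  L₀ = proj₁ (polynomial≤exponential n c′)
  A = L₀ ℕ.+ 2
  bound : ∀ L → A ℕ.+ A ℕ.≤ L → c ℕ.* (2 ℕ.+ L) ℕ.^ suc n ℕ.≤ 2 ℕ.^ L
  bound L 2A≤L = begin
    c ℕ.* (2 ℕ.+ L) ℕ.^ suc n                    ≤⟨ ℕ.*-monoʳ-≤ c (ℕ.^-monoˡ-≤ (suc n) 2+L≤2[2+K]) ⟩
    c ℕ.* (2 ℕ.* (2 ℕ.+ K)) ℕ.^ suc n            ≡⟨ cong (c ℕ.*_) (*-^ 2 (2 ℕ.+ K) (suc n)) ⟩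
    c ℕ.* (2 ℕ.^ suc n ℕ.* (2 ℕ.+ K) ℕ.^ suc n)  ≡⟨ regroup c (2 ℕ.^ suc n) (2 ℕ.+ K) ((2 ℕ.+ K) ℕ.^ n) ⟩
    c′ ℕ.* (2 ℕ.+ K) ℕ.^ n ℕ.* (2 ℕ.+ K)         ≤⟨ ℕ.*-mono-≤ (proj₂ (polynomial≤exponential n c′) K L₀≤K) (2+n≤2^n K 2≤K) ⟩
    2 ℕ.^ K ℕ.* 2 ℕ.^ K                          ≡⟨ ℕ.^-distribˡ-+-* 2 K K ⟨
    2 ℕ.^ (K ℕ.+ K)                              ≤⟨ ℕ.^-monoʳ-≤ 2 K+K≤L ⟩
    2 ℕ.^ L                                      ∎
    where
    open ℕ.≤-Reasoning
    K = ℕ.⌊ L /2⌋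
    K+K≤L = proj₁ (⌊n/2⌋-bounds L)
    L≤1+K+K = proj₂ (⌊n/2⌋-bounds L)
    A≤K : A ℕ.≤ K
    A≤K = subst₂ ℕ._≤_ (sym (ℕ.n≡⌊n+n/2⌋ A)) (sym (ℕ.n≡⌈n+n/2⌉ K)) (ℕ.⌊n/2⌋-mono (ℕ.≤-trans 2A≤L L≤1+K+K))
    L₀≤K = ℕ.≤-trans (ℕ.m≤m+n L₀ 2) A≤K
    2≤K = ℕ.≤-trans (ℕ.m≤n+m 2 L₀) A≤K
    2+L≤2[2+K] : 2 ℕ.+ L ℕ.≤ 2 ℕ.* (2 ℕ.+ K)
    2+L≤2[2+K] = ℕ.≤-trans (ℕ.+-monoʳ-≤ 2 L≤1+K+K) (ℕ.≤-trans (ℕ.n≤1+n _) (ℕ.≤-reflexive (double K)))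
      where
      double : ∀ K → suc (2 ℕ.+ suc (K ℕ.+ K)) ≡ 2 ℕ.* (2 ℕ.+ K)
      double = ℕ-Ring.solve-∀
    regroup : ∀ c t k y → c ℕ.* (t ℕ.* (k ℕ.* y)) ≡ c ℕ.* t ℕ.* y ℕ.* k
    regroup = ℕ-Ring.solve-∀
    *-^ : ∀ a b p → (a ℕ.* b) ℕ.^ p ≡ a ℕ.^ p ℕ.* b ℕ.^ p
    *-^ a b zero    = refl
    *-^ a b (suc p) = trans (cong ((a ℕ.* b) ℕ.*_) (*-^ a b p)) (interchange a b (a ℕ.^ p) (b ℕ.^ p))
      where
      interchange : ∀ a b x y → a ℕ.* b ℕ.* (x ℕ.* y) ≡ a ℕ.* x ℕ.* (b ℕ.* y)
      interchange = ℕ-Ring.solve-∀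

binary-log : ∀ M → ∃ λ L → 2 ℕ.^ L ℕ.≤ suc M × suc M ℕ.< 2 ℕ.^ suc L
binary-log zero = 0 , s≤s z≤n , s≤s (s≤s z≤n)
binary-log (suc M) with binary-log M
... | L , lower , upper with ℕ.m≤n⇒m<n∨m≡n upper
...   | inj₁ 2+M<2^L+1 = L , ℕ.m≤n⇒m≤1+n lower , 2+M<2^L+1
...   | inj₂ 2+M≡2^L+1 = suc L , ℕ.≤-reflexive (sym 2+M≡2^L+1)
                       , subst (ℕ._< 2 ℕ.^ suc (suc L)) (sym 2+M≡2^L+1) (ℕ.^-monoʳ-< 2 (s≤s (s≤s z≤n)) (ℕ.n<1+n (suc L)))

log-polynomial<linear : ∀ n c → ∃ λ N → ∀ M → N ℕ.≤ M →
  ∃ λ L → M ℕ.≤ 2 ℕ.^ suc L × c ℕ.* (2 ℕ.+ L) ℕ.^ n ℕ.< suc M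
log-polynomial<linear n c = 2 ℕ.^ L₀ , eventually
  where
  L₀ = proj₁ (polynomial≤exponential n (suc c))
  eventually : ∀ M → 2 ℕ.^ L₀ ℕ.≤ M → ∃ λ L → M ℕ.≤ 2 ℕ.^ suc L × c ℕ.* (2 ℕ.+ L) ℕ.^ n ℕ.< suc M
  eventually M 2^L₀≤M = L , ℕ.<⇒≤ (ℕ.<-trans (ℕ.n<1+n M) upper) , (begin-strict
    c ℕ.* P             <⟨ ℕ.m<n+m (c ℕ.* P) (ℕ.m^n>0 (2 ℕ.+ L) n) ⟩
    suc c ℕ.* P         ≤⟨ proj₂ (polynomial≤exponential n (suc c)) L L₀≤L ⟩
    2 ℕ.^ L             ≤⟨ lower ⟩
    suc M               ∎)
    where
    open ℕ.≤-Reasoning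
    L = proj₁ (binary-log M)
    lower = proj₁ (proj₂ (binary-log M))
    upper = proj₂ (proj₂ (binary-log M))
    P = (2 ℕ.+ L) ℕ.^ n
    L₀≤L : L₀ ℕ.≤ L
    L₀≤L = ℕ.≮⇒≥ (λ L<L₀ → ℕ.<-irrefl refl (ℕ.<-≤-trans upper
             (ℕ.≤-trans (ℕ.^-monoʳ-≤ 2 L<L₀) (ℕ.≤-trans 2^L₀≤M (ℕ.n≤1+n M)))))

theorem3p3 : (k₁ : ℕ) (ks : List ℕ) → 2 ℕ.≤ k₁ → All (1 ℕ.≤_) ks →
    (ε : ℚ) → 0ℚ < ε →
      ∃ λ N → (M : ℕ) → N ℕ.≤ M →
        ∣ LHS (k₁ ∷ ks) M - RHS (k₁ ∷ ks) M ∣ < ε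
theorem3p3 k₁ ks 2≤k₁ 1≤ks ε 0<ε with archimedean 0<ε
... | q , 1/suc[q]≤ε with log-polynomial<linear (suc (length ks)) (2 ℕ.* suc q)
... | N , eventually = N , close
  where
  close : ∀ M → N ℕ.≤ M → ∣ LHS (k₁ ∷ ks) M - RHS (k₁ ∷ ks) M ∣ < ε
  close M N≤M with eventually M N≤M
  ... | L , M≤2^[1+L] , small = begin-strict
    ∣ LHS (k₁ ∷ ks) M - RHS (k₁ ∷ ks) M ∣  ≡⟨ cong ∣_∣ (LHS-RHS≡defect k₁ ks (ℕ.≤-trans (s≤s z≤n) 2≤k₁) 1≤ks M) ⟩
    ∣ D ∣                                 ≡⟨ 0≤p⇒∣p∣≡p (defect-nonNeg k₁ M (λ m → zbarT-nonNeg ks (suc m))) ⟩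
    D                                     ≤⟨ defect-≤-ℕ k₁ ks M K 2≤k₁ 1≤ks (harmonic-≤-log L M≤2^[1+L]) ⟩
    ℕ→ℚ c * 1/suc M                       <⟨ ℕ→ℚ*1/suc<1/suc c M q (subst (ℕ._< suc M) (reshape K (K ℕ.^ r) q) small) ⟩
    1/suc q                               ≤⟨ 1/suc[q]≤ε ⟩
    ε                                     ∎
    where
    open ≤-Reasoning
    D = defect k₁ (λ m → zbarT ks (suc m)) M
    r = length ks
    K = 2 ℕ.+ L
    c = K ℕ.^ r ℕ.* (K ℕ.+ K)
    reshape : ∀ K P q → 2 ℕ.* suc q ℕ.* (K ℕ.* P) ≡ P ℕ.* (K ℕ.+ K) ℕ.* suc q
    reshape = ℕ-Ring.solve-∀
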